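{- Let $T$ be a set of rooted binary phylogenetic trees on the same leaf set $X$, let $C$ be a constraint set on $T$, and let $s$ be a cherry picking sequence for $T$ satisfying $C$. Then for every $x\in\pi_1(C)$ and every $y\in N_T(x)$, either $C\cup\{(y,x)\}$ or $C\cup\{(x,y)\}$ is also satisfied by $s$.
   Context: A tree is a rooted binary phylogenetic $X$-tree. $\mathcal{T}\setminus A$ is obtained by deleting the leaves in $A$ and repeatedly suppressing vertices with in- and out-degree one; $T\setminus A=\{\mathcal{T}\setminus A:\mathcal{T}\in T\}$. A cherry is a pair of leaves with a common parent; $(a,b)\in\mathcal{T}$ (symmetric) means $\{a,b\}$ is a cherry of $\mathcal{T}$; $(a,b)\in T$ means it is a cherry of some tree in $T$. $H(T)$ is the set of leaves in a cherry in every tree of $T$. $N_T(x)=\{y:(y,x)\in\mathcal{T}\text{ for some }\mathcal{T}\in T\}$, $w_T(x)=|N_T(x)|-1$. A cherry picking sequence for $T$ is a sequence $(s_1,\dots,s_n)$ containing each leaf exactly once with $s_i\in H(T\setminus\{s_1,\dots,s_{i-1}\})$ for $i\le n-1$. A constraint set on $T$ is a set $C\subseteq X\times X$ all of whose pairs are cherries in $T$; $s$ satisfies $C$ if for every $(a,b)\in C$ there is $i$ with $s_i=a$, $(a,b)\in T'$ and $w_{T'}(a)>0$, where $T'=T\setminus\{s_1,\dots,s_{i-1}\}$. $\pi_1(C)=\{a:(a,b)\in C\}$. -}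

module Defs where

open import Data.Nat using (ℕ; suc; _<_)
open import Data.Fin using (Fin; toℕ; _≟_)
open import Data.List using (List; []; _∷_; _++_; mapMaybe; length; lookup; take; allFin)
open import Data.List.Relation.Unary.All using (All)
open import Data.List.Relation.Unary.Any using (Any)
open import Data.List.Membership.Propositional using (_∈_)
open import Data.List.Relation.Unary.Any using (any?)
open import Data.List.Relation.Binary.Permutation.Propositional using (_↭_)
open import Data.Maybe using (Maybe; just; nothing)
open import Data.Product using (Σ; ∃; _×_; _,_)
open import Relation.Binary.PropositionalEquality using (_≡_; _≢_)
open import Relation.Nullary using (yes; no)

-- Rooted binary trees with labelled leaves (children unordered in meaning;
-- all notions below are invariant under swapping children).
data BTree (A : Set) : Set where
  leaf : A → BTree A
  node : BTree A → BTree A → BTree A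

leaves : {A : Set} → BTree A → List A
leaves (leaf a)   = a ∷ []
leaves (node l r) = leaves l ++ leaves r

-- A rooted binary phylogenetic X-tree, X = Fin n: every leaf label of X occurs exactly once.
PhyloTree : (n : ℕ) → BTree (Fin n) → Set
PhyloTree n t = leaves t ↭ allFin n

-- 𝒯 \ A : delete the leaves in A and suppress in/out-degree-one vertices
-- (nothing = all leaves deleted).
deleteLeaves : {n : ℕ} → List (Fin n) → BTree (Fin n) → Maybe (BTree (Fin n))
deleteLeaves A (leaf a) with any? (a ≟_) A
... | yes _ = nothing
... | no  _ = just (leaf a)
deleteLeaves A (node l r) with deleteLeaves A l | deleteLeaves A r
... | just l' | just r' = just (node l' r')
... | just l' | nothing = just l'
... | nothing | just r' = just r'
... | nothing | nothing = nothing

_∖_ : {n : ℕ} → List (BTree (Fin n)) → List (Fin n) → List (BTree (Fin n))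
T ∖ A = mapMaybe (deleteLeaves A) T

data IsCherry {A : Set} (a b : A) : BTree A → Set where
  here  : IsCherry a b (node (leaf a) (leaf b))
  swap  : IsCherry a b (node (leaf b) (leaf a))
  left  : ∀ {l r} → IsCherry a b l → IsCherry a b (node l r)
  right : ∀ {l r} → IsCherry a b r → IsCherry a b (node l r)

CherryIn : {n : ℕ} → Fin n → Fin n → List (BTree (Fin n)) → Set
CherryIn a b T = Any (IsCherry a b) T

InH : {n : ℕ} → Fin n → List (BTree (Fin n)) → Set
InH x T = All (λ t → ∃ λ y → IsCherry x y t) T

InN : {n : ℕ} → List (BTree (Fin n)) → Fin n → Fin n → Set
InN T x y = CherryIn y x T

-- w_T(x) > 0, i.e. |N_T(x)| ≥ 2: N_T(x) has two distinct elements
WeightPos : {n : ℕ} → List (BTree (Fin n)) → Fin n → Set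
WeightPos T x = Σ (Fin _) λ y → Σ (Fin _) λ z → y ≢ z × InN T x y × InN T x z

IsCPS : {n : ℕ} → List (BTree (Fin n)) → List (Fin n) → Set
IsCPS {n} T s = (s ↭ allFin n) ×
  ((i : Fin (length s)) → suc (toℕ i) < length s →
     InH (lookup s i) (T ∖ take (toℕ i) s))

IsConstraintSet : {n : ℕ} → List (BTree (Fin n)) → List (Fin n × Fin n) → Set
IsConstraintSet T C = All (λ { (a , b) → CherryIn a b T }) C

Satisfies : {n : ℕ} → List (BTree (Fin n)) → List (Fin n × Fin n) → List (Fin n) → Set
Satisfies T C s = All (λ { (a , b) → Σ (Fin (length s)) λ i →
    lookup s i ≡ a × CherryIn a b (T ∖ take (toℕ i) s)
                   × WeightPos (T ∖ take (toℕ i) s) a }) C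

InPi1 : {n : ℕ} → List (Fin n × Fin n) → Fin n → Set
InPi1 C x = ∃ λ b → (x , b) ∈ C

module Submission where

-- Let (x , b) ∈ C be satisfied at position i of s: s_i = x, and
-- {x , b} is a cherry of T_i = T ∖ {s_1, …, s_(i-1)} with w_(T_i)(x) > 0.
-- Let y ∈ N_T(x), i.e. {y , x} is a cherry of some tree of T.
--  * If y is not picked before position i, the cherry {x , y} survives in T_i,
--    so position i also witnesses (x , y), and C ∪ {(x , y)} is satisfied.
--  * Otherwise y = s_j with j < i.  The cherry {y , x} survives in T_j, and as
--    y ∈ H(T_j), y forms a cherry {y , z} in the restriction t' of the tree
--    t ∈ T carrying {x , b}.  Leaves of t' are distinct, so the only cherry
--    partner of x in t' is b, and y ≠ b (b is not picked before i); thus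
--    z ≠ x, w_(T_j)(y) > 0, and position j witnesses (y , x).

open import Defs
open import Data.Nat using (ℕ; suc; _<_; _≤_; z≤n; s≤s)
open import Data.Nat.Properties using (≤-<-trans; <⇒≤)
open import Data.Fin using (Fin; toℕ; _≟_) renaming (zero to fzero; suc to fsuc)
open import Data.Fin.Properties using (toℕ<n)
open import Data.List using (List; []; _∷_; _++_; mapMaybe; length; lookup; take; allFin)
open import Data.List.Relation.Unary.All as All using (All; _∷_)
import Data.List.Relation.Unary.All.Properties as AllP
open import Data.List.Relation.Unary.Any as Any using (Any; here; there; any?)
import Data.List.Relation.Unary.Any.Properties as AnyP
open import Data.List.Relation.Unary.AllPairs using (AllPairs; []; _∷_)
open import Data.List.Membership.Propositional using (_∈_; _∉_; find)
open import Data.List.Membership.Propositional.Properties using (∈-++⁺ˡ; ∈-++⁺ʳ; ∈-++⁻; ∈-lookup)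
open import Data.List.Relation.Binary.Permutation.Propositional using (_↭_; ↭-sym; ↭⇒↭ₛ)
open import Data.List.Relation.Unary.Unique.Propositional.Properties using (allFin⁺)
import Data.List.Relation.Binary.Permutation.Setoid.Properties as PermProps
open import Data.Maybe using (Maybe; just; nothing)
import Data.Maybe.Relation.Unary.Any as MaybeAny
open import Data.Product using (Σ; ∃; ∃₂; _×_; _,_; proj₁; proj₂; map₁)
open import Data.Sum using (_⊎_; inj₁; inj₂)
open import Data.Empty using (⊥-elim)
open import Relation.Nullary using (yes; no)
open import Relation.Binary.PropositionalEquality using (_≡_; _≢_; refl; sym; subst; setoid)

module _ {A B : Set} (f : A → Maybe B) where

  Any-mapMaybe⁺ : ∀ {P : B → Set} {xs x y} → x ∈ xs → f x ≡ just y → P y →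
    Any P (mapMaybe f xs)
  Any-mapMaybe⁺ {P} {x = x} x∈xs fx≡y py =
    AnyP.mapMaybe⁺ f _ (AnyP.map⁺ (Any.map image x∈xs))
    where
    image : ∀ {x′} → x ≡ x′ → MaybeAny.Any P (f x′)
    image refl = subst (MaybeAny.Any P) (sym fx≡y) (MaybeAny.just py)

  Any-mapMaybe⁻ : ∀ {P : B → Set} xs → Any P (mapMaybe f xs) →
    ∃₂ λ x y → x ∈ xs × f x ≡ just y × P y
  Any-mapMaybe⁻ (x ∷ xs) p with f x in fx≡y | p
  ... | just y  | here py = x , y , here refl , fx≡y , py
  ... | just _  | there p′ with Any-mapMaybe⁻ xs p′
  ...   | x′ , y′ , x′∈ , e , py′ = x′ , y′ , there x′∈ , e , py′
  Any-mapMaybe⁻ (x ∷ xs) _ | nothing | p with Any-mapMaybe⁻ xs p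
  ...   | x′ , y′ , x′∈ , e , py′ = x′ , y′ , there x′∈ , e , py′

  All-mapMaybe⁻ : ∀ {Q : B → Set} {xs} → All Q (mapMaybe f xs) →
    ∀ {x y} → x ∈ xs → f x ≡ just y → Q y
  All-mapMaybe⁻ all x∈xs fx≡y = All.lookup all (Any-mapMaybe⁺ x∈xs fx≡y refl)

module _ {A : Set} where

  lookup∉prefix : (s : List A) → AllPairs _≢_ s → (i : Fin (length s)) →
    lookup s i ∉ take (toℕ i) s
  lookup∉prefix (a ∷ s) u         fzero    ()
  lookup∉prefix (a ∷ s) (a∉s ∷ u) (fsuc i) (here e)  = All.lookup a∉s (∈-lookup i) (sym e)
  lookup∉prefix (a ∷ s) (_ ∷ u)   (fsuc i) (there m) = lookup∉prefix s u i m

  ∈prefix⇒earlier : (s : List A) (i : Fin (length s)) {y : A} → y ∈ take (toℕ i) s →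
    ∃ λ (j : Fin (length s)) → toℕ j < toℕ i × lookup s j ≡ y
  ∈prefix⇒earlier (a ∷ s) fzero    ()
  ∈prefix⇒earlier (a ∷ s) (fsuc i) (here e)  = fzero , s≤s z≤n , sym e
  ∈prefix⇒earlier (a ∷ s) (fsuc i) (there m) with ∈prefix⇒earlier s i m
  ... | j , j<i , sj≡y = fsuc j , s≤s j<i , sj≡y

  AllPairs-++⁻ : ∀ (xs : List A) {ys : List A} → AllPairs _≢_ (xs ++ ys) →
    AllPairs _≢_ xs × AllPairs _≢_ ys × (∀ {a} → a ∈ xs → a ∉ ys)
  AllPairs-++⁻ []       u        = [] , u , λ ()
  AllPairs-++⁻ (x ∷ xs) {ys} (x∉ ∷ u) with AllPairs-++⁻ xs u
  ... | uxs , uys , disjoint = AllP.++⁻ˡ xs x∉ ∷ uxs , uys , disjoint′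
    where
    disjoint′ : ∀ {a} → a ∈ x ∷ xs → a ∉ ys
    disjoint′ (here refl) a∈ys = All.lookup x∉ (∈-++⁺ʳ xs a∈ys) refl
    disjoint′ (there a∈xs)    = disjoint a∈xs

  take-mono : ∀ {m k} (s : List A) {b : A} → m ≤ k → b ∈ take m s → b ∈ take k s
  take-mono {suc m} {suc k} (a ∷ s) (s≤s m≤k) (here e)  = here e
  take-mono {suc m} {suc k} (a ∷ s) (s≤s m≤k) (there p) = there (take-mono s m≤k p)

↭allFin⇒distinct : ∀ {n} {xs : List (Fin n)} → xs ↭ allFin n → AllPairs _≢_ xs
↭allFin⇒distinct {n} p = PermProps.Unique-resp-↭ (setoid _) (↭⇒↭ₛ (↭-sym p)) (allFin⁺ n)

module _ {A : Set} where

  cherry-sym : ∀ {a b : A} {t} → IsCherry a b t → IsCherry b a t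
  cherry-sym here      = swap
  cherry-sym swap      = here
  cherry-sym (left c)  = left (cherry-sym c)
  cherry-sym (right c) = right (cherry-sym c)

  cherry⇒leaves : ∀ {a b : A} {t} → IsCherry a b t → a ∈ leaves t × b ∈ leaves t
  cherry⇒leaves here = here refl , there (here refl)
  cherry⇒leaves swap = there (here refl) , here refl
  cherry⇒leaves (left c) with cherry⇒leaves c
  ... | a∈l , b∈l = ∈-++⁺ˡ a∈l , ∈-++⁺ˡ b∈l
  cherry⇒leaves (right {l = l} c) with cherry⇒leaves c
  ... | a∈r , b∈r = ∈-++⁺ʳ (leaves l) a∈r , ∈-++⁺ʳ (leaves l) b∈r

  -- A tree has distinct leaves when, at every node, the two subtrees share no
  -- leaf label.  This recursive form follows the recursion of IsCherry.
  data DistinctLeaves : BTree A → Set where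
    leaf : ∀ {a} → DistinctLeaves (leaf a)
    node : ∀ {l r} → DistinctLeaves l → DistinctLeaves r →
           (∀ {a} → a ∈ leaves l → a ∉ leaves r) → DistinctLeaves (node l r)

  distinctLeaves : ∀ t → AllPairs _≢_ (leaves t) → DistinctLeaves t
  distinctLeaves (leaf a)   _ = leaf
  distinctLeaves (node l r) u with AllPairs-++⁻ (leaves l) u
  ... | ul , ur , disjoint = node (distinctLeaves l ul) (distinctLeaves r ur) disjoint

  cherry-partner-unique : ∀ {x b y : A} {t} → DistinctLeaves t →
    IsCherry x b t → IsCherry x y t → y ≡ b
  cherry-partner-unique _ here here = refl
  cherry-partner-unique _ here swap = refl
  cherry-partner-unique _ swap here = refl
  cherry-partner-unique _ swap swap = refl
  cherry-partner-unique (node dl _ _) (left c)  (left c′)  = cherry-partner-unique dl c c′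
  cherry-partner-unique (node _ dr _) (right c) (right c′) = cherry-partner-unique dr c c′
  cherry-partner-unique (node _ _ disjoint) (left c)  (right c′) =
    ⊥-elim (disjoint (proj₁ (cherry⇒leaves c)) (proj₁ (cherry⇒leaves c′)))
  cherry-partner-unique (node _ _ disjoint) (right c) (left c′)  =
    ⊥-elim (disjoint (proj₁ (cherry⇒leaves c′)) (proj₁ (cherry⇒leaves c)))

module _ {n : ℕ} {A : List (Fin n)} where

  keep-leaf : ∀ {a} → a ∉ A → deleteLeaves A (leaf a) ≡ just (leaf a)
  keep-leaf {a} a∉A with any? (a ≟_) A
  ... | yes a∈A = ⊥-elim (a∉A a∈A)
  ... | no  _   = refl

  cherry-survives : ∀ {a b t} → IsCherry a b t → a ∉ A → b ∉ A →
    ∃ λ t′ → deleteLeaves A t ≡ just t′ × IsCherry a b t′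
  cherry-survives here a∉A b∉A rewrite keep-leaf a∉A | keep-leaf b∉A = _ , refl , here
  cherry-survives swap a∉A b∉A rewrite keep-leaf a∉A | keep-leaf b∉A = _ , refl , swap
  cherry-survives (left {r = r} c) a∉A b∉A with cherry-survives c a∉A b∉A
  ... | l′ , l↦l′ , c′ with deleteLeaves A r
  ...   | just _  rewrite l↦l′ = _ , refl , left c′
  ...   | nothing rewrite l↦l′ = _ , refl , c′
  cherry-survives (right {l = l} c) a∉A b∉A with cherry-survives c a∉A b∉A
  ... | r′ , r↦r′ , c′ with deleteLeaves A l
  ...   | just _  rewrite r↦r′ = _ , refl , right c′
  ...   | nothing rewrite r↦r′ = _ , refl , c′

  restrict-leaves : ∀ t {t′ a} → deleteLeaves A t ≡ just t′ → a ∈ leaves t′ →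
    a ∈ leaves t × a ∉ A
  restrict-leaves (leaf c) t↦t′ a∈t′ with any? (c ≟_) A
  restrict-leaves (leaf c) ()   a∈t′        | yes _
  restrict-leaves (leaf c) refl (here refl) | no c∉A = here refl , c∉A
  restrict-leaves (node l r) t↦t′ a∈t′ with deleteLeaves A l in l↦l′ | deleteLeaves A r in r↦r′
  restrict-leaves (node l r) refl a∈t′ | just l′ | just r′ with ∈-++⁻ (leaves l′) a∈t′
  ... | inj₁ a∈l′ = map₁ ∈-++⁺ˡ (restrict-leaves l l↦l′ a∈l′)
  ... | inj₂ a∈r′ = map₁ (∈-++⁺ʳ (leaves l)) (restrict-leaves r r↦r′ a∈r′)
  restrict-leaves (node l r) refl a∈t′ | just l′ | nothing =
    map₁ ∈-++⁺ˡ (restrict-leaves l l↦l′ a∈t′)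
  restrict-leaves (node l r) refl a∈t′ | nothing | just r′ =
    map₁ (∈-++⁺ʳ (leaves l)) (restrict-leaves r r↦r′ a∈t′)
  restrict-leaves (node l r) () a∈t′ | nothing | nothing

  restrict-distinct : ∀ t {t′} → DistinctLeaves t → deleteLeaves A t ≡ just t′ →
    DistinctLeaves t′
  restrict-distinct (leaf c) _ t↦t′ with any? (c ≟_) A
  restrict-distinct (leaf c) _ ()   | yes _
  restrict-distinct (leaf c) _ refl | no  _ = leaf
  restrict-distinct (node l r) (node dl dr disjoint) t↦t′
    with deleteLeaves A l in l↦l′ | deleteLeaves A r in r↦r′
  ... | just l′ | just r′ with t↦t′
  ...   | refl = node (restrict-distinct l dl l↦l′) (restrict-distinct r dr r↦r′)
                   λ a∈l′ a∈r′ → disjoint (proj₁ (restrict-leaves l l↦l′ a∈l′))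
                                           (proj₁ (restrict-leaves r r↦r′ a∈r′))
  restrict-distinct (node l r) (node dl _ _) refl | just l′ | nothing = restrict-distinct l dl l↦l′
  restrict-distinct (node l r) (node _ dr _) refl | nothing | just r′ = restrict-distinct r dr r↦r′
  restrict-distinct (node l r) _ () | nothing | nothing

module _ {n : ℕ} (T : List (BTree (Fin n))) (A : List (Fin n)) where

  cherry-∖⁺ : ∀ {a b} → CherryIn a b T → a ∉ A → b ∉ A → CherryIn a b (T ∖ A)
  cherry-∖⁺ ab∈T a∉A b∉A with find ab∈T
  ... | t , t∈T , ab∈t with cherry-survives ab∈t a∉A b∉A
  ...   | t′ , t↦t′ , ab∈t′ = Any-mapMaybe⁺ (deleteLeaves A) t∈T t↦t′ ab∈t′

  cherry-∖⇒∉ : ∀ {a b} → CherryIn a b (T ∖ A) → b ∉ A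
  cherry-∖⇒∉ ab∈T∖A with Any-mapMaybe⁻ (deleteLeaves A) T ab∈T∖A
  ... | t , t′ , _ , t↦t′ , ab∈t′ =
    proj₂ (restrict-leaves t t↦t′ (proj₂ (cherry⇒leaves ab∈t′)))

  weight-positive : ∀ {x b y} → All (PhyloTree n) T → CherryIn x b T →
    x ∉ A → b ∉ A → y ∉ A → y ≢ b → InN T x y → InH y (T ∖ A) → WeightPos (T ∖ A) y
  weight-positive {x} phylo xb∈T x∉A b∉A y∉A y≢b yx∈T y∈H with find xb∈T
  ... | t , t∈T , xb∈t with cherry-survives xb∈t x∉A b∉A
  ...   | t′ , t↦t′ , xb∈t′ with All-mapMaybe⁻ (deleteLeaves A) y∈H t∈T t↦t′
  ...     | z , yz∈t′ = x , z , x≢z , cherry-∖⁺ (Any.map cherry-sym yx∈T) x∉A y∉A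
                            , Any-mapMaybe⁺ (deleteLeaves A) t∈T t↦t′ (cherry-sym yz∈t′)
    where
    t′-distinct : DistinctLeaves t′
    t′-distinct = restrict-distinct t
      (distinctLeaves t (↭allFin⇒distinct (All.lookup phylo t∈T))) t↦t′
    x≢z : x ≢ z
    x≢z refl = y≢b (cherry-partner-unique t′-distinct xb∈t′ (cherry-sym yz∈t′))

mainTheorem4 : (n : ℕ) (T : List (BTree (Fin n))) → All (PhyloTree n) T →
    (C : List (Fin n × Fin n)) → IsConstraintSet T C →
    (s : List (Fin n)) → IsCPS T s → Satisfies T C s →
    (x : Fin n) → InPi1 C x → (y : Fin n) → InN T x y →
    Satisfies T ((y , x) ∷ C) s ⊎ Satisfies T ((x , y) ∷ C) s
mainTheorem4 n T phylo C constraints s (s↭X , picks) satisfied x (b , xb∈C) y yx∈T =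
  extend (All.lookup satisfied xb∈C)
  where
  prefix : Fin (length s) → List (Fin n)
  prefix k = take (toℕ k) s

  picked∉prefix : ∀ {k z} → lookup s k ≡ z → z ∉ prefix k
  picked∉prefix {k} refl = lookup∉prefix s (↭allFin⇒distinct s↭X) k

  ∉-earlier : ∀ {j i z} → toℕ j < toℕ i → z ∉ prefix i → z ∉ prefix j
  ∉-earlier j<i z∉ᵢ z∈ⱼ = z∉ᵢ (take-mono s (<⇒≤ j<i) z∈ⱼ)

  extend : (Σ (Fin (length s)) λ i → lookup s i ≡ x × CherryIn x b (T ∖ prefix i)
                                   × WeightPos (T ∖ prefix i) x) →
    Satisfies T ((y , x) ∷ C) s ⊎ Satisfies T ((x , y) ∷ C) s
  extend (i , sᵢ≡x , xb∈Tᵢ , wᵢ) with any? (y ≟_) (prefix i)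
  ... | no y∉ᵢ =
    inj₂ ((i , sᵢ≡x , cherry-∖⁺ T (prefix i) (Any.map cherry-sym yx∈T) (picked∉prefix sᵢ≡x) y∉ᵢ
             , wᵢ) ∷ satisfied)
  ... | yes y∈ᵢ with ∈prefix⇒earlier s i y∈ᵢ
  ...   | j , j<i , sⱼ≡y =
    inj₁ ((j , sⱼ≡y , cherry-∖⁺ T (prefix j) yx∈T y∉ⱼ x∉ⱼ , wⱼ) ∷ satisfied)
    where
    b∉ᵢ : b ∉ prefix i
    b∉ᵢ = cherry-∖⇒∉ T (prefix i) xb∈Tᵢ
    x∉ⱼ : x ∉ prefix j
    x∉ⱼ = ∉-earlier j<i (picked∉prefix sᵢ≡x)
    y∉ⱼ : y ∉ prefix j
    y∉ⱼ = picked∉prefix sⱼ≡y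
    y≢b : y ≢ b
    y≢b y≡b = b∉ᵢ (subst (_∈ prefix i) y≡b y∈ᵢ)
    y∈Hⱼ : InH y (T ∖ prefix j)
    y∈Hⱼ = subst (λ w → InH w (T ∖ prefix j)) sⱼ≡y (picks j (≤-<-trans j<i (toℕ<n i)))
    wⱼ : WeightPos (T ∖ prefix j) y
    wⱼ = weight-positive T (prefix j) phylo (All.lookup constraints xb∈C)
           x∉ⱼ (∉-earlier j<i b∉ᵢ) y∉ⱼ y≢b yx∈T y∈Hⱼ
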